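{- If $P$ is a maximal geodesic in $P_{d_1} \boxtimes \cdots \boxtimes P_{d_r}$, where $r\ge 2$ and $d_1,\ldots,d_r\ge 2$, then $n(P)\in\{d_1,\ldots,d_r\}$.
   Context: $P_d$ denotes the path on $d$ vertices, and $n(P)$ the number of vertices of $P$. The strong product $G\boxtimes H$ has vertex set $V(G)\times V(H)$, with $(g,h)$ adjacent to $(g',h')$ iff either $g=g'$ and $hh'\in E(H)$, or $h=h'$ and $gg'\in E(G)$, or $gg'\in E(G)$ and $hh'\in E(H)$. A geodesic is a shortest path; it is maximal if it is not contained as a subpath in any other geodesic. -}

module Defs where

open import Level using (Level; suc; _⊔_) renaming (zero to 0ℓ)
open import Data.Nat using (ℕ; _≤_; _<_) renaming (suc to sucℕ)
open import Data.Fin using (Fin; toℕ)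
open import Data.List using (List; []; _∷_; length; _++_)
open import Data.Product using (_×_; Σ; ∃; ∃-syntax; _,_)
open import Data.Sum using (_⊎_)
open import Data.Empty using (⊥)
open import Data.Unit using (⊤)
open import Relation.Binary.PropositionalEquality using (_≡_)

record Graph : Set₁ where
  field
    V   : Set
    Adj : V → V → Set
open Graph public

Path : ℕ → Graph
Path d = record
  { V   = Fin d
  ; Adj = λ i j → (toℕ j ≡ sucℕ (toℕ i)) ⊎ (toℕ i ≡ sucℕ (toℕ j)) }

_⊠_ : Graph → Graph → Graph
G ⊠ H = record
  { V   = V G × V H
  ; Adj = λ { (g , h) (g' , h') →
        ((g ≡ g') × Adj H h h')
      ⊎ ((h ≡ h') × Adj G g g')
      ⊎ (Adj G g g' × Adj H h h') } }

-- Iterated strong product P_{d₁} ⊠ (P_{d₂} ⊠ (⋯ ⊠ P_{d_r})) for a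
-- nonempty list of sizes (d₁ , [d₂,…,d_r]).
StrongPaths : ℕ → List ℕ → Graph
StrongPaths d []       = Path d
StrongPaths d (e ∷ ds) = Path d ⊠ StrongPaths e ds

AllAtLeast2 : List ℕ → Set
AllAtLeast2 []       = ⊤
AllAtLeast2 (d ∷ ds) = (2 ≤ d) × AllAtLeast2 ds

_∈ℕ_ : ℕ → List ℕ → Set
n ∈ℕ []       = ⊥
n ∈ℕ (d ∷ ds) = (n ≡ d) ⊎ (n ∈ℕ ds)

module _ (G : Graph) where

  IsWalk : List (V G) → Set
  IsWalk []           = ⊥
  IsWalk (x ∷ [])     = ⊤
  IsWalk (x ∷ y ∷ xs) = Adj G x y × IsWalk (y ∷ xs)

  StartsAt : V G → List (V G) → Set
  StartsAt u []      = ⊥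
  StartsAt u (x ∷ _) = u ≡ x

  EndsAt : V G → List (V G) → Set
  EndsAt v []           = ⊥
  EndsAt v (x ∷ [])     = v ≡ x
  EndsAt v (x ∷ y ∷ xs) = EndsAt v (y ∷ xs)

  WalkFromTo : V G → V G → List (V G) → Set
  WalkFromTo u v P = IsWalk P × StartsAt u P × EndsAt v P

  -- A geodesic (shortest path): a u–v walk with no u–v walk having fewer
  -- vertices. (Such a walk automatically has distinct vertices.)
  -- n(P) is `length P`, the number of vertices.
  IsGeodesic : List (V G) → Set
  IsGeodesic P = Σ (V G) λ u → Σ (V G) λ v →
    WalkFromTo u v P × (∀ W → WalkFromTo u v W → length P ≤ length W)

  Subpath : List (V G) → List (V G) → Set
  Subpath P Q = ∃[ xs ] ∃[ ys ] (xs ++ P ++ ys ≡ Q)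

  IsMaximalGeodesic : List (V G) → Set
  IsMaximalGeodesic P = IsGeodesic P ×
    (∀ Q → IsGeodesic Q → Subpath P Q → length Q ≤ length P)

-- The distance in P_{d₁} ⊠ ⋯ ⊠ P_{d_r} is the maximum of the coordinate
-- distances |xᵢ - yᵢ|, and a geodesic from u to v has exactly dist(u,v) + 1
-- vertices.  A geodesic can be prolonged by one vertex beyond an endpoint as
-- soon as one coordinate realising the maximum can be moved one step away
-- from the other endpoint.  This is impossible only when that coordinate
-- already runs from one end of P_{dᵢ} to the other, i.e. when the geodesic
-- has dᵢ vertices.
module Submission where

open import Defs
open import Data.Nat using (ℕ; zero; suc; _+_; _⊔_; ∣_-_∣; _≤_; _<_; z≤n; s≤s; _<?_)
open import Data.Nat.Properties
open import Data.List using (List; []; _∷_; length; _++_)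
open import Data.List.Properties using (length-++; ++-identityʳ)
open import Data.Fin using (Fin; toℕ; fromℕ<)
open import Data.Fin.Properties using (toℕ-fromℕ<; toℕ-injective; toℕ<n)
open import Data.Product using (Σ-syntax; _×_; _,_)
open import Data.Sum using (_⊎_; inj₁; inj₂; swap; [_,_]′)
open import Data.Unit using (tt)
open import Data.Empty using (⊥; ⊥-elim)
open import Relation.Nullary using (yes; no)
open import Relation.Binary.PropositionalEquality

-- Either a u–v geodesic can be prolonged beyond v or before u, or its vertex
-- count belongs to L.
Extension : (G : Graph) → (V G → V G → ℕ) → List ℕ → V G → V G → Set
Extension G dist L u v = (Σ[ w ∈ V G ] Adj G v w × dist u w ≡ suc (dist u v))
                       ⊎ (Σ[ w ∈ V G ] Adj G w u × dist w v ≡ suc (dist u v))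
                       ⊎ suc (dist u v) ∈ℕ L

Extension-swap : ∀ {G dist L} → (∀ {a b} → Adj G a b → Adj G b a) → (∀ a b → dist a b ≡ dist b a) →
                 ∀ {u v} → Extension G dist L v u → Extension G dist L u v
Extension-swap {dist = dist} {L} adj-sym dist-sym {u} {v} = λ
  { (inj₁ (w , adj , e))        → inj₂ (inj₁ (w , adj-sym adj , trans (dist-sym w v) (trans e 1+dist-vu≡1+dist-uv)))
  ; (inj₂ (inj₁ (w , adj , e))) → inj₁ (w , adj-sym adj , trans (dist-sym u w) (trans e 1+dist-vu≡1+dist-uv))
  ; (inj₂ (inj₂ mem))           → inj₂ (inj₂ (subst (λ x → suc x ∈ℕ L) (dist-sym v u) mem))
  }
  where
  1+dist-vu≡1+dist-uv : suc (dist v u) ≡ suc (dist u v)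
  1+dist-vu≡1+dist-uv = cong suc (dist-sym v u)

record ExtensibleDistance (G : Graph) (L : List ℕ) : Set where
  field
    dist      : V G → V G → ℕ
    dist-self : ∀ a → dist a a ≡ 0
    dist≡0⇒≡  : ∀ {a b} → dist a b ≡ 0 → a ≡ b
    dist-step : ∀ u {a b} → Adj G a b → dist u b ≤ suc (dist u a)
    descend   : ∀ a b {m} → dist a b ≡ suc m → Σ[ c ∈ V G ] Adj G a c × dist c b ≡ m
    extend    : ∀ u v → Extension G dist L u v

∣m-1+m∣≡1 : ∀ m → ∣ m - suc m ∣ ≡ 1
∣m-1+m∣≡1 zero    = refl
∣m-1+m∣≡1 (suc m) = ∣m-1+m∣≡1 m

m≤n⇒∣m-1+n∣≡1+∣m-n∣ : ∀ {m n} → m ≤ n → ∣ m - suc n ∣ ≡ suc ∣ m - n ∣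
m≤n⇒∣m-1+n∣≡1+∣m-n∣ z≤n     = refl
m≤n⇒∣m-1+n∣≡1+∣m-n∣ (s≤s p) = m≤n⇒∣m-1+n∣≡1+∣m-n∣ p

m<n⇒∣m-n∣≡1+∣1+m-n∣ : ∀ {m n} → m < n → ∣ m - n ∣ ≡ suc ∣ suc m - n ∣
m<n⇒∣m-n∣≡1+∣1+m-n∣ (s≤s p) = m≤n⇒∣m-1+n∣≡1+∣m-n∣ p

∣m-n∣≡1+k⇒stepToward : ∀ m n {k} → ∣ m - n ∣ ≡ suc k →
  (m < n × ∣ suc m - n ∣ ≡ k) ⊎ (Σ[ m′ ∈ ℕ ] m ≡ suc m′ × ∣ m′ - n ∣ ≡ k)
∣m-n∣≡1+k⇒stepToward zero    (suc n) e = inj₁ (s≤s z≤n , suc-injective e)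
∣m-n∣≡1+k⇒stepToward (suc m) zero    e = inj₂ (m , refl , trans (∣-∣-identityʳ m) (suc-injective e))
∣m-n∣≡1+k⇒stepToward (suc m) (suc n) e with ∣m-n∣≡1+k⇒stepToward m n e
... | inj₁ (m<n , e′)       = inj₁ (s≤s m<n , e′)
... | inj₂ (m′ , refl , e′) = inj₂ (suc m′ , refl , e′)

module _ {d : ℕ} where

  private
    dist : Fin d → Fin d → ℕ
    dist i j = ∣ toℕ i - toℕ j ∣

  pathVertex : ∀ {k} → k < d → Σ[ i ∈ Fin d ] toℕ i ≡ k
  pathVertex k<d = fromℕ< k<d , toℕ-fromℕ< k<d

  Path-adj⇒dist≡1 : ∀ {i j} → Adj (Path d) i j → dist i j ≡ 1
  Path-adj⇒dist≡1 {i} (inj₁ e) rewrite e = ∣m-1+m∣≡1 (toℕ i)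
  Path-adj⇒dist≡1 {j = j} (inj₂ e) rewrite e = trans (∣-∣-comm (suc (toℕ j)) (toℕ j)) (∣m-1+m∣≡1 (toℕ j))

  Path-dist-step : ∀ u {a b} → Adj (Path d) a b → dist u b ≤ suc (dist u a)
  Path-dist-step u {a} {b} adj = begin
    dist u b            ≤⟨ ∣-∣-triangle (toℕ u) (toℕ a) (toℕ b) ⟩
    dist u a + dist a b ≡⟨ cong (dist u a +_) (Path-adj⇒dist≡1 adj) ⟩
    dist u a + 1        ≡⟨ +-comm (dist u a) 1 ⟩
    suc (dist u a)      ∎
    where open ≤-Reasoning

  Path-descend : ∀ a b {m} → dist a b ≡ suc m → Σ[ c ∈ Fin d ] Adj (Path d) a c × dist c b ≡ m
  Path-descend a b e with ∣m-n∣≡1+k⇒stepToward (toℕ a) (toℕ b) e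
  ... | inj₁ (a<b , e′) with pathVertex (<-≤-trans (s≤s a<b) (toℕ<n b))
  ...   | c , c≡1+a = c , inj₁ c≡1+a , trans (cong (λ x → ∣ x - toℕ b ∣) c≡1+a) e′
  Path-descend a b e | inj₂ (a′ , a≡1+a′ , e′) with pathVertex (<-trans (≤-reflexive (sym a≡1+a′)) (toℕ<n a))
  ...   | c , c≡a′ = c , inj₂ (trans a≡1+a′ (cong suc (sym c≡a′))) , trans (cong (λ x → ∣ x - toℕ b ∣) c≡a′) e′

  -- When u ≤ v cannot be prolonged on either side, u = 0 and v = d - 1.
  Path-extend-≤ : ∀ u v → toℕ u ≤ toℕ v → Extension (Path d) dist (d ∷ []) u v
  Path-extend-≤ u v u≤v with suc (toℕ v) <? d
  ... | yes 1+v<d with pathVertex 1+v<d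
  ...   | w , w≡1+v = inj₁ (w , inj₁ w≡1+v ,
                             trans (cong (λ x → ∣ toℕ u - x ∣) w≡1+v) (m≤n⇒∣m-1+n∣≡1+∣m-n∣ u≤v))
  Path-extend-≤ u v u≤v | no 1+v≮d with toℕ u in u≡
  ... | zero  = inj₂ (inj₂ (inj₁ (≤-antisym (toℕ<n v) (≮⇒≥ 1+v≮d))))
  ... | suc u′ with pathVertex (<-trans (n<1+n u′) (subst (_< d) u≡ (toℕ<n u)))
  ...   | w , w≡u′ = inj₂ (inj₁ (w , inj₁ (cong suc (sym w≡u′)) ,
                                   trans (cong (λ x → ∣ x - toℕ v ∣) w≡u′) (m<n⇒∣m-n∣≡1+∣1+m-n∣ u≤v)))

  Path-extend : ∀ u v → Extension (Path d) dist (d ∷ []) u v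
  Path-extend u v with ≤-total (toℕ u) (toℕ v)
  ... | inj₁ u≤v = Path-extend-≤ u v u≤v
  ... | inj₂ v≤u = Extension-swap swap (λ i j → ∣-∣-comm (toℕ i) (toℕ j)) (Path-extend-≤ v u v≤u)

pathDistance : ∀ d → ExtensibleDistance (Path d) (d ∷ [])
pathDistance d = record
  { dist      = λ i j → ∣ toℕ i - toℕ j ∣
  ; dist-self = λ i → ∣n-n∣≡0 (toℕ i)
  ; dist≡0⇒≡  = λ e → toℕ-injective (∣m-n∣≡0⇒m≡n e)
  ; dist-step = Path-dist-step
  ; descend   = Path-descend
  ; extend    = Path-extend
  }

∈ℕ-++⁺ˡ : ∀ {n} xs {ys} → n ∈ℕ xs → n ∈ℕ (xs ++ ys)
∈ℕ-++⁺ˡ (x ∷ xs) (inj₁ n≡x) = inj₁ n≡x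
∈ℕ-++⁺ˡ (x ∷ xs) (inj₂ n∈xs) = inj₂ (∈ℕ-++⁺ˡ xs n∈xs)

∈ℕ-++⁺ʳ : ∀ {n} xs {ys} → n ∈ℕ ys → n ∈ℕ (xs ++ ys)
∈ℕ-++⁺ʳ []       n∈ys = n∈ys
∈ℕ-++⁺ʳ (x ∷ xs) n∈ys = inj₂ (∈ℕ-++⁺ʳ xs n∈ys)

1+m⊔n≡1+[m⊔n] : ∀ {m n} → n ≤ m → suc m ⊔ n ≡ suc (m ⊔ n)
1+m⊔n≡1+[m⊔n] n≤m = trans (m≥n⇒m⊔n≡m (m≤n⇒m≤1+n n≤m)) (cong suc (sym (m≥n⇒m⊔n≡m n≤m)))

m⊔1+n≡1+[m⊔n] : ∀ {m n} → m ≤ n → m ⊔ suc n ≡ suc (m ⊔ n)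
m⊔1+n≡1+[m⊔n] m≤n = trans (m≤n⇒m⊔n≡n (m≤n⇒m≤1+n m≤n)) (cong suc (sym (m≤n⇒m⊔n≡n m≤n)))

module _ {G H L₁ L₂} (DG : ExtensibleDistance G L₁) (DH : ExtensibleDistance H L₂) where

  private
    module G = ExtensibleDistance DG
    module H = ExtensibleDistance DH

    dist : V (G ⊠ H) → V (G ⊠ H) → ℕ
    dist (g , h) (g′ , h′) = G.dist g g′ ⊔ H.dist h h′

  ⊠-dist≡0⇒≡ : ∀ {a b} → dist a b ≡ 0 → a ≡ b
  ⊠-dist≡0⇒≡ {g , h} {g′ , h′} e = cong₂ _,_
    (G.dist≡0⇒≡ (n≤0⇒n≡0 (subst (G.dist g g′ ≤_) e (m≤m⊔n _ _))))
    (H.dist≡0⇒≡ (n≤0⇒n≡0 (subst (H.dist h h′ ≤_) e (m≤n⊔m _ _))))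

  ⊠-dist-step : ∀ u {a b} → Adj (G ⊠ H) a b → dist u b ≤ suc (dist u a)
  ⊠-dist-step (p , q) (inj₁ (refl , adjH))        = ⊔-mono-≤ (n≤1+n _) (H.dist-step q adjH)
  ⊠-dist-step (p , q) (inj₂ (inj₁ (refl , adjG))) = ⊔-mono-≤ (G.dist-step p adjG) (n≤1+n _)
  ⊠-dist-step (p , q) (inj₂ (inj₂ (adjG , adjH))) = ⊔-mono-≤ (G.dist-step p adjG) (H.dist-step q adjH)

  -- Each coordinate at positive distance takes one step; the others stay put.
  ⊠-descend : ∀ a b {m} → dist a b ≡ suc m → Σ[ c ∈ V (G ⊠ H) ] Adj (G ⊠ H) a c × dist c b ≡ m
  ⊠-descend (g , h) (g′ , h′) e with G.dist g g′ in eG | H.dist h h′ in eH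
  ... | suc x | zero with G.descend g g′ eG
  ...   | c , adj , eG′ = (c , h) , inj₂ (inj₁ (refl , adj)) ,
                          trans (cong₂ _⊔_ eG′ eH) (trans (⊔-identityʳ x) (suc-injective e))
  ⊠-descend (g , h) (g′ , h′) e | zero | suc y with H.descend h h′ eH
  ...   | c , adj , eH′ = (g , c) , inj₁ (refl , adj) , trans (cong₂ _⊔_ eG eH′) (suc-injective e)
  ⊠-descend (g , h) (g′ , h′) e | suc x | suc y with G.descend g g′ eG | H.descend h h′ eH
  ...   | c , adjG , eG′ | c′ , adjH , eH′ =
          (c , c′) , inj₂ (inj₂ (adjG , adjH)) , trans (cong₂ _⊔_ eG′ eH′) (suc-injective e)

  -- Prolong in a coordinate realising the maximum.
  ⊠-extend : ∀ u v → Extension (G ⊠ H) dist (L₁ ++ L₂) u v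
  ⊠-extend (g , h) (g′ , h′) with ≤-total (H.dist h h′) (G.dist g g′)
  ... | inj₁ dH≤dG with G.extend g g′
  ...   | inj₁ (w , adj , e) = inj₁ ((w , h′) , inj₂ (inj₁ (refl , adj)) ,
                                     trans (cong (_⊔ H.dist h h′) e) (1+m⊔n≡1+[m⊔n] dH≤dG))
  ...   | inj₂ (inj₁ (w , adj , e)) = inj₂ (inj₁ ((w , h) , inj₂ (inj₁ (refl , adj)) ,
                                     trans (cong (_⊔ H.dist h h′) e) (1+m⊔n≡1+[m⊔n] dH≤dG)))
  ...   | inj₂ (inj₂ mem) = inj₂ (inj₂ (∈ℕ-++⁺ˡ L₁
                              (subst (λ x → suc x ∈ℕ L₁) (sym (m≥n⇒m⊔n≡m dH≤dG)) mem)))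
  ⊠-extend (g , h) (g′ , h′) | inj₂ dG≤dH with H.extend h h′
  ...   | inj₁ (w , adj , e) = inj₁ ((g′ , w) , inj₁ (refl , adj) ,
                                     trans (cong (G.dist g g′ ⊔_) e) (m⊔1+n≡1+[m⊔n] dG≤dH))
  ...   | inj₂ (inj₁ (w , adj , e)) = inj₂ (inj₁ ((g , w) , inj₁ (refl , adj) ,
                                     trans (cong (G.dist g g′ ⊔_) e) (m⊔1+n≡1+[m⊔n] dG≤dH)))
  ...   | inj₂ (inj₂ mem) = inj₂ (inj₂ (∈ℕ-++⁺ʳ L₁
                              (subst (λ x → suc x ∈ℕ L₂) (sym (m≤n⇒m⊔n≡n dG≤dH)) mem)))

  ⊠-distance : ExtensibleDistance (G ⊠ H) (L₁ ++ L₂)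
  ⊠-distance = record
    { dist      = dist
    ; dist-self = λ { (g , h) → cong₂ _⊔_ (G.dist-self g) (H.dist-self h) }
    ; dist≡0⇒≡  = ⊠-dist≡0⇒≡
    ; dist-step = ⊠-dist-step
    ; descend   = ⊠-descend
    ; extend    = ⊠-extend
    }

strongPathsDistance : ∀ d ds → ExtensibleDistance (StrongPaths d ds) (d ∷ ds)
strongPathsDistance d []       = pathDistance d
strongPathsDistance d (e ∷ ds) = ⊠-distance (pathDistance d) (strongPathsDistance e ds)

module _ {G : Graph} where

  snoc-walk : ∀ {u v w} P → WalkFromTo G u v P → Adj G v w → WalkFromTo G u w (P ++ w ∷ [])
  snoc-walk (x ∷ [])     (_ , refl , refl) adj = (adj , tt) , refl , refl
  snoc-walk (x ∷ y ∷ P) ((adj′ , walk) , refl , end) adj with snoc-walk (y ∷ P) (walk , refl , end) adj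
  ... | walk′ , _ , end′ = (adj′ , walk′) , refl , end′

  cons-walk : ∀ {u v w} P → Adj G w u → WalkFromTo G u v P → WalkFromTo G w v (w ∷ P)
  cons-walk (x ∷ P) adj (walk , refl , end) = (adj , walk) , refl , end

  module _ {L} (D : ExtensibleDistance G L) where
    open ExtensibleDistance D

    dist≤dist+walk-length : ∀ s x P {t} → IsWalk G (x ∷ P) → EndsAt G t (x ∷ P) → dist s t ≤ dist s x + length P
    dist≤dist+walk-length s x []      _            refl = ≤-reflexive (sym (+-identityʳ (dist s x)))
    dist≤dist+walk-length s x (y ∷ P) (adj , walk) end = begin
      dist s _                   ≤⟨ dist≤dist+walk-length s y P walk end ⟩
      dist s y + length P        ≤⟨ +-monoˡ-≤ (length P) (dist-step s adj) ⟩
      suc (dist s x) + length P  ≡⟨ sym (+-suc (dist s x) (length P)) ⟩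
      dist s x + length (y ∷ P)  ∎
      where open ≤-Reasoning

    dist<walk-length : ∀ {u v} P → WalkFromTo G u v P → dist u v < length P
    dist<walk-length {u} (x ∷ P) (walk , refl , end) =
      s≤s (subst (λ d₀ → dist u _ ≤ d₀ + length P) (dist-self u) (dist≤dist+walk-length u u P walk end))

    shortest-walk : ∀ u v → Σ[ P ∈ List (V G) ] WalkFromTo G u v P × length P ≡ suc (dist u v)
    shortest-walk u v = go (dist u v) u refl
      where
      go : ∀ k a → dist a v ≡ k → Σ[ P ∈ List (V G) ] WalkFromTo G a v P × length P ≡ suc k
      go zero a e with dist≡0⇒≡ e
      ... | refl = (a ∷ []) , (tt , refl , refl) , refl
      go (suc k) a e with descend a v e
      ... | c , adj , e′ with go k c e′
      ...   | P , walk , len = a ∷ P , cons-walk P adj walk , cong suc len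

    geodesic-length : ∀ {u v} P → WalkFromTo G u v P →
                      (∀ W → WalkFromTo G u v W → length P ≤ length W) → length P ≡ suc (dist u v)
    geodesic-length {u} {v} P walk shortest with shortest-walk u v
    ... | W , walkW , lenW = ≤-antisym (≤-trans (shortest W walkW) (≤-reflexive lenW)) (dist<walk-length P walk)

    length≡1+dist⇒isGeodesic : ∀ {u v} Q → WalkFromTo G u v Q → length Q ≡ suc (dist u v) → IsGeodesic G Q
    length≡1+dist⇒isGeodesic Q walk len =
      _ , _ , walk , λ W walkW → ≤-trans (≤-reflexive len) (dist<walk-length W walkW)

    maximalGeodesic-length∈ : ∀ P → IsMaximalGeodesic G P → length P ∈ℕ L
    maximalGeodesic-length∈ P ((u , v , walk , shortest) , maximal) =
      [ prolongEnd , [ prolongStart , subst (_∈ℕ L) (sym lengthP) ]′ ]′ (extend u v)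
      where
      lengthP : length P ≡ suc (dist u v)
      lengthP = geodesic-length P walk shortest

      longerGeodesic : ∀ {u′ v′} Q → WalkFromTo G u′ v′ Q → Subpath G P Q →
                       length Q ≡ suc (length P) → dist u′ v′ ≡ suc (dist u v) → ⊥
      longerGeodesic Q walkQ P⊆Q lengthQ e =
        <⇒≱ (≤-reflexive (sym lengthQ)) (maximal Q Q-geodesic P⊆Q)
        where
        Q-geodesic : IsGeodesic G Q
        Q-geodesic = length≡1+dist⇒isGeodesic Q walkQ
          (trans lengthQ (trans (cong suc lengthP) (cong suc (sym e))))

      prolongEnd : Σ[ w ∈ V G ] Adj G v w × dist u w ≡ suc (dist u v) → length P ∈ℕ L
      prolongEnd (w , adj , e) = ⊥-elim (longerGeodesic (P ++ w ∷ []) (snoc-walk P walk adj)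
        ([] , w ∷ [] , refl) (trans (length-++ P) (+-comm (length P) 1)) e)

      prolongStart : Σ[ w ∈ V G ] Adj G w u × dist w v ≡ suc (dist u v) → length P ∈ℕ L
      prolongStart (w , adj , e) = ⊥-elim (longerGeodesic (w ∷ P) (cons-walk P adj walk)
        (w ∷ [] , [] , cong (w ∷_) (++-identityʳ P)) refl e)

lemma4p1 : (d₁ d₂ : ℕ) (ds : List ℕ) →
    AllAtLeast2 (d₁ ∷ d₂ ∷ ds) →
    (P : List (V (StrongPaths d₁ (d₂ ∷ ds)))) →
    IsMaximalGeodesic (StrongPaths d₁ (d₂ ∷ ds)) P →
    length P ∈ℕ (d₁ ∷ d₂ ∷ ds)
lemma4p1 d₁ d₂ ds _ = maximalGeodesic-length∈ (strongPathsDistance d₁ (d₂ ∷ ds))
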